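{- Let $G_0$ be a stepwise irregular graph having a vertex $u$ of degree $1$. Let $G_1$ be obtained from $G_0$ by adding six new vertices $a,b,c,d,e,f$ and the eight new edges $ua,\ ab,\ bc,\ cd,\ de,\ eu,\ df,\ fb$. Then $G_1$ is stepwise irregular, and if $G_0$ has cyclomatic number $\gamma$, then $G_1$ has cyclomatic number $\gamma+2$.
   Context: All graphs are finite and simple. A graph $G$ is stepwise irregular (SI) if for every edge $uv\in E(G)$ one has $|d_G(u)-d_G(v)|=1$, where $d_G$ denotes degree. The cyclomatic number of a connected graph with $n$ vertices and $m$ edges is $\gamma=m-n+1$. -}

module Defs where

open import Data.Nat using (ℕ; zero; suc; ∣_-_∣)
import Data.Nat
open import Data.Nat.Properties using ()
open import Data.Integer as ℤ using (ℤ; +_)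
open import Data.Fin using (Fin; zero; suc; splitAt; _<?_; _≟_)
open import Data.List using (List; map; allFin)
open import Data.Nat.ListAction using (sum)
open import Data.Bool using (Bool; true; false; _∧_; _∨_; if_then_else_)
open import Data.Bool.Properties using (∨-comm)
open import Data.Sum using (_⊎_; inj₁; inj₂)
open import Relation.Nullary using (does)
open import Relation.Binary.PropositionalEquality using (_≡_; refl)

record Graph (n : ℕ) : Set where
  field
    adj    : Fin n → Fin n → Bool
    sym    : ∀ i j → adj i j ≡ adj j i
    irrefl : ∀ i → adj i i ≡ false
open Graph public

deg : ∀ {n} → Graph n → Fin n → ℕ
deg {n} G v = sum (map (λ w → if adj G v w then 1 else 0) (allFin n))

edges : ∀ {n} → Graph n → ℕ
edges {n} G =
  sum (map (λ i → sum (map (λ j → if does (i <? j) ∧ adj G i j then 1 else 0)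
                           (allFin n)))
           (allFin n))

cyclomatic : ∀ {n} → Graph n → ℤ
cyclomatic {n} G = (+ edges G ℤ.- + n) ℤ.+ + 1

StepwiseIrregular : ∀ {n} → Graph n → Set
StepwiseIrregular G = ∀ x y → adj G x y ≡ true → ∣ deg G x - deg G y ∣ ≡ 1

-- Vertex set Fin (n + 6): old vertex i is  i ↑ˡ 6,  new vertices are
-- n ↑ʳ k for k : Fin 6, with a = 0, b = 1, c = 2, d = 3, e = 4, f = 5.
-- New edges: ua, ab, bc, cd, de, eu, df, fb.

newArc : Fin 6 → Fin 6 → Bool
newArc zero (suc zero) = true                                  -- ab
newArc (suc zero) (suc (suc zero)) = true                      -- bc
newArc (suc (suc zero)) (suc (suc (suc zero))) = true          -- cd
newArc (suc (suc (suc zero))) (suc (suc (suc (suc zero)))) = true          -- de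
newArc (suc (suc (suc zero))) (suc (suc (suc (suc (suc zero))))) = true    -- df
newArc (suc (suc (suc (suc (suc zero))))) (suc zero) = true                -- fb
newArc _ _ = false

newAdj : Fin 6 → Fin 6 → Bool
newAdj k l = newArc k l ∨ newArc l k

newAdj-sym : ∀ k l → newAdj k l ≡ newAdj l k
newAdj-sym k l = ∨-comm (newArc k l) (newArc l k)

newAdj-irrefl : ∀ k → newAdj k k ≡ false
newAdj-irrefl zero = refl
newAdj-irrefl (suc zero) = refl
newAdj-irrefl (suc (suc zero)) = refl
newAdj-irrefl (suc (suc (suc zero))) = refl
newAdj-irrefl (suc (suc (suc (suc zero)))) = refl
newAdj-irrefl (suc (suc (suc (suc (suc zero))))) = refl

isAE : Fin 6 → Bool
isAE zero = true
isAE (suc (suc (suc (suc zero)))) = true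
isAE _ = false

module _ {n : ℕ} (G : Graph n) (u : Fin n) where

  extAdj′ : Fin n ⊎ Fin 6 → Fin n ⊎ Fin 6 → Bool
  extAdj′ (inj₁ i) (inj₁ j) = adj G i j
  extAdj′ (inj₁ i) (inj₂ k) = does (i ≟ u) ∧ isAE k
  extAdj′ (inj₂ k) (inj₁ i) = does (i ≟ u) ∧ isAE k
  extAdj′ (inj₂ k) (inj₂ l) = newAdj k l

  extAdj′-sym : ∀ x y → extAdj′ x y ≡ extAdj′ y x
  extAdj′-sym (inj₁ i) (inj₁ j) = sym G i j
  extAdj′-sym (inj₁ i) (inj₂ k) = refl
  extAdj′-sym (inj₂ k) (inj₁ i) = refl
  extAdj′-sym (inj₂ k) (inj₂ l) = newAdj-sym k l

  extAdj′-irrefl : ∀ x → extAdj′ x x ≡ false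
  extAdj′-irrefl (inj₁ i) = irrefl G i
  extAdj′-irrefl (inj₂ k) = newAdj-irrefl k

  extend : Graph (n Data.Nat.+ 6)
  extend = record
    { adj    = λ x y → extAdj′ (splitAt n x) (splitAt n y)
    ; sym    = λ x y → extAdj′-sym (splitAt n x) (splitAt n y)
    ; irrefl = λ x → extAdj′-irrefl (splitAt n x)
    }

-- Then, for G₁: an old vertex keeps its degree, except u, which gains a and e
-- (degree 1 + 2 = 3); a,b,c,d,e,f have degrees 2,3,2,3,2,2.  Stepwise
-- irregularity is checked edge by edge: edges of G₀ away from u are unchanged;
-- the G₀-neighbour of the leaf u has degree 2 (as |1 - d| = 1 and d ≥ 1, a
-- general fact about leaves); ua, ue join degrees 3 and 2; the six gadget edges
-- are a finite check.  Finally G₁ has the edges of G₀, two edges at u and six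
-- gadget edges, so m₁ = m₀ + 8.
module Submission where

open import Defs hiding (sym)
open import Data.Product using (_×_; _,_)
open import Relation.Binary.PropositionalEquality
  using (_≡_; refl; sym; trans; cong; cong₂; subst; subst₂; module ≡-Reasoning)

module Counting where

  open import Data.Nat using (ℕ; zero; suc; _+_; _≤_; ∣_-_∣)
  import Data.Nat as ℕ
  open import Data.Nat.Properties
    using (+-0-commutativeMonoid; +-assoc; +-identityʳ; m≤m+n; m≤n+m; ≤-trans; <-≤-trans; <⇒≤; <⇒≱;
           +-cancelˡ-<; +-monoʳ-<)
  open import Data.Nat.ListAction using () renaming (sum to listSum)
  open import Data.Fin using (Fin; zero; suc; splitAt; _↑ˡ_; _↑ʳ_; toℕ; _≟_; _<?_)
  open import Data.Fin.Patterns using (0F; 1F; 2F; 3F; 4F; 5F)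
  open import Data.Fin.Properties using (toℕ-↑ˡ; toℕ-↑ʳ; toℕ<n; splitAt-↑ˡ; splitAt-↑ʳ; all?)
  open import Data.List using (map; allFin; tabulate)
  open import Data.List.Properties using (map-tabulate)
  open import Data.Bool using (Bool; true; false; _∧_; if_then_else_)
  import Data.Bool as Bool
  open import Data.Bool.Properties using (∧-identityʳ; ∧-zeroʳ)
  open import Data.Sum using (_⊎_; inj₁; inj₂)
  open import Algebra.Properties.CommutativeMonoid.Sum +-0-commutativeMonoid
    using (sum; sum-syntax; ∑-distrib-+; sum-cong-≗; sum-replicate-zero)
  open import Function using (_∘_; id; mk⇔)
  open import Relation.Nullary using (Dec; does; yes; no; contradiction)
  open import Relation.Binary.PropositionalEquality using (_≢_)
  open import Relation.Nullary.Decidable using (dec-true; dec-false; does-⇔; toWitness; _→-dec_)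

  open ≡-Reasoning

  ind : Bool → ℕ
  ind b = if b then 1 else 0

  listSum-allFin : ∀ n (f : Fin n → ℕ) → listSum (map f (allFin n)) ≡ ∑[ i < n ] f i
  listSum-allFin n f = trans (cong listSum (map-tabulate id f)) (tabulated n f)
    where
    tabulated : ∀ n (f : Fin n → ℕ) → listSum (tabulate f) ≡ sum f
    tabulated zero    f = refl
    tabulated (suc n) f = cong (f zero +_) (tabulated n (f ∘ suc))

  ∑-↑ : ∀ n m (f : Fin (n + m) → ℕ) →
        sum f ≡ ∑[ i < n ] f (i ↑ˡ m) + ∑[ k < m ] f (n ↑ʳ k)
  ∑-↑ zero    m f = refl
  ∑-↑ (suc n) m f = trans (cong (f zero +_) (∑-↑ n m (f ∘ suc))) (sym (+-assoc (f zero) _ _))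

  ∑-splitAt : ∀ n m (h : Fin n ⊎ Fin m → ℕ) →
              ∑[ x < n + m ] h (splitAt n x) ≡ ∑[ i < n ] h (inj₁ i) + ∑[ k < m ] h (inj₂ k)
  ∑-splitAt n m h = trans (∑-↑ n m (h ∘ splitAt n))
    (cong₂ _+_ (sum-cong-≗ λ i → cong h (splitAt-↑ˡ n i m))
               (sum-cong-≗ λ k → cong h (splitAt-↑ʳ n m k)))

  ∑-δ : ∀ {n} (u : Fin n) (c : ℕ) → ∑[ j < n ] (if does (j ≟ u) then c else 0) ≡ c
  ∑-δ {suc n} zero    c = trans (cong (c +_) (sum-replicate-zero n)) (+-identityʳ c)
  ∑-δ {suc n} (suc u) c = ∑-δ u c

  term≤∑ : ∀ {n} (f : Fin n → ℕ) w → f w ≤ sum f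
  term≤∑ f zero    = m≤m+n (f zero) _
  term≤∑ f (suc w) = ≤-trans (term≤∑ (f ∘ suc) w) (m≤n+m _ (f zero))

  <?-toℕ : ∀ {n} {x y : Fin n} {a b : ℕ} → toℕ x ≡ a → toℕ y ≡ b →
           does (x <? y) ≡ does (a ℕ.<? b)
  <?-toℕ = cong₂ (λ a b → does (a ℕ.<? b))

  <?-↑ˡ : ∀ {n} m (i j : Fin n) → does (i ↑ˡ m <? j ↑ˡ m) ≡ does (i <? j)
  <?-↑ˡ m i j = <?-toℕ (toℕ-↑ˡ i m) (toℕ-↑ˡ j m)

  <?-↑ʳ : ∀ n {m} (k l : Fin m) → does (n ↑ʳ k <? n ↑ʳ l) ≡ does (k <? l)
  <?-↑ʳ n k l = trans (<?-toℕ (toℕ-↑ʳ n k) (toℕ-↑ʳ n l))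
    (does-⇔ (mk⇔ (+-cancelˡ-< n (toℕ k) (toℕ l)) (+-monoʳ-< n)) (n + toℕ k ℕ.<? n + toℕ l) (k <? l))

  <?-↑ˡ↑ʳ : ∀ {n m} (i : Fin n) (k : Fin m) → does (i ↑ˡ m <? n ↑ʳ k) ≡ true
  <?-↑ˡ↑ʳ {n} {m} i k = trans (<?-toℕ (toℕ-↑ˡ i m) (toℕ-↑ʳ n k))
    (dec-true (toℕ i ℕ.<? n + toℕ k) (<-≤-trans (toℕ<n i) (m≤m+n n (toℕ k))))

  <?-↑ʳ↑ˡ : ∀ {n m} (k : Fin m) (j : Fin n) → does (n ↑ʳ k <? j ↑ˡ m) ≡ false
  <?-↑ʳ↑ˡ {n} {m} k j = trans (<?-toℕ (toℕ-↑ʳ n k) (toℕ-↑ˡ j m))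
    (dec-false (n + toℕ k ℕ.<? toℕ j)
      λ n+k<j → <⇒≱ (toℕ<n j) (≤-trans (m≤m+n n (toℕ k)) (<⇒≤ n+k<j)))

  deg-as-∑ : ∀ {n} (G : Graph n) v → deg G v ≡ ∑[ w < n ] ind (adj G v w)
  deg-as-∑ {n} G v = listSum-allFin n _

  edges-as-∑ : ∀ {n} (G : Graph n) →
               edges G ≡ ∑[ i < n ] ∑[ j < n ] ind (does (i <? j) ∧ adj G i j)
  edges-as-∑ {n} G = trans (listSum-allFin n (λ i → listSum (map (row i) (allFin n))))
                             (sum-cong-≗ λ i → listSum-allFin n (row i))
    where
    row : Fin n → Fin n → ℕ
    row i j = ind (does (i <? j) ∧ adj G i j)

  adj⇒≢ : ∀ {n} (G : Graph n) {v w} → adj G v w ≡ true → v ≢ w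
  adj⇒≢ G {v} vw refl = contradiction (trans (sym vw) (irrefl G v)) λ ()

  adj⇒deg-pos : ∀ {n} (G : Graph n) v w → adj G v w ≡ true → 1 ≤ deg G v
  adj⇒deg-pos G v w vw = subst₂ _≤_ (cong ind vw) (sym (deg-as-∑ G v))
    (term≤∑ (λ w′ → ind (adj G v w′)) w)

  leaf-neighbour-deg : ∀ {n} (G : Graph n) {u v} → StepwiseIrregular G →
                       deg G u ≡ 1 → adj G u v ≡ true → deg G v ≡ 2
  leaf-neighbour-deg G {u} {v} si du uv =
    two (deg G v) (adj⇒deg-pos G v u (trans (Graph.sym G v u) uv))
        (subst₂ (λ a b → ∣ a - b ∣ ≡ 1) du refl (si u v uv))
    where
    two : ∀ d → 1 ≤ d → ∣ 1 - d ∣ ≡ 1 → d ≡ 2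
    two (suc (suc zero)) _ _ = refl
    two (suc zero) _ ()
    two (suc (suc (suc d))) _ ()

  newDeg : Fin 6 → ℕ
  newDeg 0F = 2
  newDeg 1F = 3
  newDeg 2F = 2
  newDeg 3F = 3
  newDeg 4F = 2
  newDeg 5F = 2

  newDeg-correct : ∀ k → ind (isAE k) + ∑[ l < 6 ] ind (newAdj k l) ≡ newDeg k
  newDeg-correct 0F = refl
  newDeg-correct 1F = refl
  newDeg-correct 2F = refl
  newDeg-correct 3F = refl
  newDeg-correct 4F = refl
  newDeg-correct 5F = refl

  newDeg-SI : ∀ k l → newAdj k l ≡ true → ∣ newDeg k - newDeg l ∣ ≡ 1
  newDeg-SI = toWitness {a? = all? λ k → all? λ l →
    (newAdj k l Bool.≟ true) →-dec (∣ newDeg k - newDeg l ∣ ℕ.≟ 1)} _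

  newDeg-AE : ∀ k → isAE k ≡ true → newDeg k ≡ 2
  newDeg-AE 0F _ = refl
  newDeg-AE 1F ()
  newDeg-AE 2F ()
  newDeg-AE 3F ()
  newDeg-AE 4F _ = refl
  newDeg-AE 5F ()

  newEdges : ∑[ k < 6 ] ∑[ l < 6 ] ind (does (k <? l) ∧ newAdj k l) ≡ 6
  newEdges = refl

  module Extension {n : ℕ} (G : Graph n) (u : Fin n) where

    G₁ : Graph (n + 6)
    G₁ = extend G u

    bonus : Fin n → ℕ
    bonus i = if does (i ≟ u) then 2 else 0

    extDeg : Fin n ⊎ Fin 6 → ℕ
    extDeg (inj₁ i) = deg G i + bonus i
    extDeg (inj₂ k) = newDeg k

    attached : ∀ j k → does (j ≟ u) ∧ isAE k ≡ true → j ≡ u × isAE k ≡ true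
    attached j k h with j ≟ u
    ... | yes j≡u = j≡u , h

    ∑-attached : ∀ b → ∑[ j < n ] ind (does (j ≟ u) ∧ b) ≡ ind b
    ∑-attached true  = trans (sum-cong-≗ λ j → cong ind (∧-identityʳ (does (j ≟ u)))) (∑-δ u 1)
    ∑-attached false = trans (sum-cong-≗ λ j → cong ind (∧-zeroʳ (does (j ≟ u)))) (sum-replicate-zero n)

    ∑-bonus : ∀ i → ∑[ k < 6 ] ind (does (i ≟ u) ∧ isAE k) ≡ bonus i
    ∑-bonus i with does (i ≟ u)
    ... | true  = refl
    ... | false = refl

    deg-extend : ∀ x → deg G₁ x ≡ extDeg (splitAt n x)
    deg-extend x = begin
      deg G₁ x                                           ≡⟨ deg-as-∑ G₁ x ⟩
      ∑[ y < n + 6 ] ind (extAdj′ G u X (splitAt n y))   ≡⟨ ∑-splitAt n 6 (ind ∘ extAdj′ G u X) ⟩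
      ∑[ j < n ] ind (extAdj′ G u X (inj₁ j))
        + ∑[ l < 6 ] ind (extAdj′ G u X (inj₂ l))        ≡⟨ by-side X ⟩
      extDeg X                                           ∎
      where
      X = splitAt n x
      by-side : ∀ X → ∑[ j < n ] ind (extAdj′ G u X (inj₁ j))
                      + ∑[ l < 6 ] ind (extAdj′ G u X (inj₂ l)) ≡ extDeg X
      by-side (inj₁ i) = cong₂ _+_ (sym (deg-as-∑ G i)) (∑-bonus i)
      by-side (inj₂ k) = trans (cong (_+ _) (∑-attached (isAE k))) (newDeg-correct k)

    edges-extend : edges G₁ ≡ edges G + 8
    edges-extend = begin
      edges G₁                                              ≡⟨ edges-as-∑ G₁ ⟩
      ∑[ x < n + 6 ] ∑[ y < n + 6 ] E x y                   ≡⟨ ∑-↑ n 6 _ ⟩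
      ∑[ i < n ] ∑[ y < n + 6 ] E (i ↑ˡ 6) y
        + ∑[ k < 6 ] ∑[ y < n + 6 ] E (n ↑ʳ k) y            ≡⟨ cong₂ _+_ (sum-cong-≗ old-row) (sum-cong-≗ new-row) ⟩
      ∑[ i < n ] (oldE i + bonus i) + 6                     ≡⟨ cong (_+ 6) (∑-distrib-+ oldE bonus) ⟩
      (sum oldE + sum bonus) + 6                            ≡⟨ cong (_+ 6) (cong₂ _+_ (sym (edges-as-∑ G)) (∑-δ u 2)) ⟩
      (edges G + 2) + 6                                     ≡⟨ +-assoc (edges G) 2 6 ⟩
      edges G + 8                                           ∎
      where
      E : Fin (n + 6) → Fin (n + 6) → ℕ
      E x y = ind (does (x <? y) ∧ adj G₁ x y)

      oldE : Fin n → ℕ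
      oldE i = ∑[ j < n ] ind (does (i <? j) ∧ adj G i j)

      old-row : ∀ i → ∑[ y < n + 6 ] E (i ↑ˡ 6) y ≡ oldE i + bonus i
      old-row i = trans (∑-↑ n 6 _) (cong₂ _+_ (sum-cong-≗ old-old) (trans (sum-cong-≗ old-new) (∑-bonus i)))
        where
        old-old : ∀ j → E (i ↑ˡ 6) (j ↑ˡ 6) ≡ ind (does (i <? j) ∧ adj G i j)
        old-old j = cong₂ (λ b c → ind (b ∧ c)) (<?-↑ˡ 6 i j)
                          (cong₂ (extAdj′ G u) (splitAt-↑ˡ n i 6) (splitAt-↑ˡ n j 6))
        old-new : ∀ l → E (i ↑ˡ 6) (n ↑ʳ l) ≡ ind (does (i ≟ u) ∧ isAE l)
        old-new l = cong₂ (λ b c → ind (b ∧ c)) (<?-↑ˡ↑ʳ i l)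
                          (cong₂ (extAdj′ G u) (splitAt-↑ˡ n i 6) (splitAt-↑ʳ n 6 l))

      new-row : ∀ k → ∑[ y < n + 6 ] E (n ↑ʳ k) y ≡ ∑[ l < 6 ] ind (does (k <? l) ∧ newAdj k l)
      new-row k = trans (∑-↑ n 6 _)
        (cong₂ _+_ (trans (sum-cong-≗ new-old) (sum-replicate-zero n)) (sum-cong-≗ new-new))
        where
        new-old : ∀ j → E (n ↑ʳ k) (j ↑ˡ 6) ≡ 0
        new-old j = cong (λ b → ind (b ∧ adj G₁ (n ↑ʳ k) (j ↑ˡ 6))) (<?-↑ʳ↑ˡ k j)
        new-new : ∀ l → E (n ↑ʳ k) (n ↑ʳ l) ≡ ind (does (k <? l) ∧ newAdj k l)
        new-new l = cong₂ (λ b c → ind (b ∧ c)) (<?-↑ʳ n k l)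
                          (cong₂ (extAdj′ G u) (splitAt-↑ʳ n 6 k) (splitAt-↑ʳ n 6 l))

    module _ (si : StepwiseIrregular G) (du : deg G u ≡ 1) where

      extDeg-u : ∀ {i} → i ≡ u → extDeg (inj₁ i) ≡ 3
      extDeg-u {i} i≡u rewrite dec-true (i ≟ u) i≡u | i≡u | du = refl

      extDeg-far : ∀ i → i ≢ u → extDeg (inj₁ i) ≡ deg G i
      extDeg-far i i≢u rewrite dec-false (i ≟ u) i≢u = +-identityʳ (deg G i)

      extDeg-leaf-neighbour : ∀ {i j} → i ≡ u → adj G i j ≡ true → extDeg (inj₁ j) ≡ 2
      extDeg-leaf-neighbour {i} {j} i≡u ij =
        trans (extDeg-far j λ j≡u → adj⇒≢ G ij (trans i≡u (sym j≡u)))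
              (leaf-neighbour-deg G si du (subst (λ v → adj G v j ≡ true) i≡u ij))

      extDeg-SI : ∀ X Y → extAdj′ G u X Y ≡ true → ∣ extDeg X - extDeg Y ∣ ≡ 1
      extDeg-SI (inj₁ i) (inj₁ j) h = old-edge (i ≟ u) (j ≟ u)
        where
        old-edge : Dec (i ≡ u) → Dec (j ≡ u) → ∣ extDeg (inj₁ i) - extDeg (inj₁ j) ∣ ≡ 1
        old-edge (yes i≡u) _ = cong₂ ∣_-_∣ (extDeg-u i≡u) (extDeg-leaf-neighbour i≡u h)
        old-edge (no _) (yes j≡u) =
          cong₂ ∣_-_∣ (extDeg-leaf-neighbour j≡u (trans (Graph.sym G j i) h)) (extDeg-u j≡u)
        old-edge (no i≢u) (no j≢u) =
          trans (cong₂ ∣_-_∣ (extDeg-far i i≢u) (extDeg-far j j≢u)) (si i j h)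
      extDeg-SI (inj₁ i) (inj₂ k) h with attached i k h
      ... | i≡u , ae = cong₂ ∣_-_∣ (extDeg-u i≡u) (newDeg-AE k ae)
      extDeg-SI (inj₂ k) (inj₁ i) h with attached i k h
      ... | i≡u , ae = cong₂ ∣_-_∣ (newDeg-AE k ae) (extDeg-u i≡u)
      extDeg-SI (inj₂ k) (inj₂ l) h = newDeg-SI k l h

      extend-SI : StepwiseIrregular G₁
      extend-SI x y h =
        subst₂ (λ a b → ∣ a - b ∣ ≡ 1) (sym (deg-extend x)) (sym (deg-extend y))
          (extDeg-SI (splitAt n x) (splitAt n y) h)

open Counting using (module Extension)
open Extension using (extend-SI; edges-extend)

open import Data.Nat using (ℕ)
import Data.Nat as ℕ
open import Data.Fin using (Fin)
open import Data.Integer using (ℤ; _+_; +_; _-_)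
open import Data.Integer.Properties using (pos-+)
open import Data.Integer.Tactic.RingSolver using (solve-∀)

cyclomatic-growth : ∀ {n k} c (G : Graph n) (H : Graph (n ℕ.+ k)) →
                    edges H ≡ edges G ℕ.+ (k ℕ.+ c) → cyclomatic H ≡ cyclomatic G + + c
cyclomatic-growth {n} {k} c G H eH
  rewrite eH | pos-+ (edges G) (k ℕ.+ c) | pos-+ k c | pos-+ n k =
  arithmetic (+ edges G) (+ n) (+ k) (+ c)
  where
  arithmetic : ∀ e m k c → (e + (k + c) - (m + k)) + + 1 ≡ ((e - m) + + 1) + c
  arithmetic = solve-∀

mainTheorem5 : ∀ {n : ℕ} (G₀ : Graph n) (u : Fin n) →
    StepwiseIrregular G₀ → deg G₀ u ≡ 1 →
    StepwiseIrregular (extend G₀ u) ×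
    (∀ (γ : ℤ) → cyclomatic G₀ ≡ γ → cyclomatic (extend G₀ u) ≡ γ + + 2)
mainTheorem5 G₀ u si du =
  extend-SI G₀ u si du ,
  λ γ γ₀ → trans (cyclomatic-growth 2 G₀ (extend G₀ u) (edges-extend G₀ u)) (cong (_+ + 2) γ₀)
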